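{- For all terms $s,s'$: if $s$ is reducible by $\to_{R_2,ACh}$ and $s\approx_{AC}s'$, then $s'$ is reducible by $\to_{R_2,ACh}$.
   Context: Terms are over $\{+,h,0\}$, variables and free constants. $R_2$ is the rewrite system $x+x\to0$, $x+0\to x$, $x+(y+x)\to y$, $h(0)\to0$. $ACh$ is the theory generated by associativity and commutativity of $+$ and $h(x+y)\approx h(x)+h(y)$; $AC$ is associativity and commutativity of $+$. $t\to_{R_2,ACh}t'$ iff there are a non-variable position $p$ of $t$, a rule $l\to r\in R_2$ and a substitution $\sigma$ with $t|_p=_{ACh}l\sigma$ and $t'=t[r\sigma]_p$. -}

module Defs where

open import Data.Nat using (ℕ)
open import Data.List using (List; []; _∷_)
open import Data.Maybe using (Maybe; just; nothing; map)
open import Data.Product using (Σ; ∃; _×_; _,_)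
open import Relation.Binary.PropositionalEquality using (_≡_)
open import Relation.Nullary using (¬_)

data Term : Set where
  var  : ℕ → Term
  cst  : ℕ → Term
  𝟘    : Term
  _⊕_  : Term → Term → Term
  h    : Term → Term

infixl 6 _⊕_

Subst : Set
Subst = ℕ → Term

_⟨_⟩ : Term → Subst → Term
var n   ⟨ σ ⟩ = σ n
cst c   ⟨ σ ⟩ = cst c
𝟘       ⟨ σ ⟩ = 𝟘
(s ⊕ t) ⟨ σ ⟩ = (s ⟨ σ ⟩) ⊕ (t ⟨ σ ⟩)
h t     ⟨ σ ⟩ = h (t ⟨ σ ⟩)

data _≈ACh_ : Term → Term → Set where
  refl  : ∀ {s} → s ≈ACh s
  sym   : ∀ {s t} → s ≈ACh t → t ≈ACh s
  trans : ∀ {s t u} → s ≈ACh t → t ≈ACh u → s ≈ACh u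
  cong⊕ : ∀ {s s' t t'} → s ≈ACh s' → t ≈ACh t' → (s ⊕ t) ≈ACh (s' ⊕ t')
  congh : ∀ {s s'} → s ≈ACh s' → h s ≈ACh h s'
  assoc : ∀ x y z → ((x ⊕ y) ⊕ z) ≈ACh (x ⊕ (y ⊕ z))
  comm  : ∀ x y → (x ⊕ y) ≈ACh (y ⊕ x)
  hom   : ∀ x y → h (x ⊕ y) ≈ACh (h x ⊕ h y)

data _≈AC_ : Term → Term → Set where
  refl  : ∀ {s} → s ≈AC s
  sym   : ∀ {s t} → s ≈AC t → t ≈AC s
  trans : ∀ {s t u} → s ≈AC t → t ≈AC u → s ≈AC u
  cong⊕ : ∀ {s s' t t'} → s ≈AC s' → t ≈AC t' → (s ⊕ t) ≈AC (s' ⊕ t')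
  congh : ∀ {s s'} → s ≈AC s' → h s ≈AC h s'
  assoc : ∀ x y z → ((x ⊕ y) ⊕ z) ≈AC (x ⊕ (y ⊕ z))
  comm  : ∀ x y → (x ⊕ y) ≈AC (y ⊕ x)

data Dir : Set where
  left right arg : Dir

Pos : Set
Pos = List Dir

_∣_ : Term → Pos → Maybe Term
t       ∣ []          = just t
(s ⊕ t) ∣ (left ∷ p)  = s ∣ p
(s ⊕ t) ∣ (right ∷ p) = t ∣ p
h t     ∣ (arg ∷ p)   = t ∣ p
_       ∣ (_ ∷ _)     = nothing

_[_]at_ : Term → Term → Pos → Maybe Term
t       [ u ]at []          = just u
(s ⊕ t) [ u ]at (left ∷ p)  = map (λ s' → s' ⊕ t) (s [ u ]at p)
(s ⊕ t) [ u ]at (right ∷ p) = map (λ t' → s ⊕ t') (t [ u ]at p)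
h t     [ u ]at (arg ∷ p)   = map h (t [ u ]at p)
_       [ u ]at (_ ∷ _)     = nothing

IsVar : Term → Set
IsVar t = ∃ λ n → t ≡ var n

-- The rewrite system R₂ (x = var 0, y = var 1)
data RuleR₂ : Set where
  ρ₁ ρ₂ ρ₃ ρ₄ : RuleR₂

lhs rhs : RuleR₂ → Term
lhs ρ₁ = var 0 ⊕ var 0
lhs ρ₂ = var 0 ⊕ 𝟘
lhs ρ₃ = var 0 ⊕ (var 1 ⊕ var 0)
lhs ρ₄ = h 𝟘
rhs ρ₁ = 𝟘
rhs ρ₂ = var 0
rhs ρ₃ = var 1
rhs ρ₄ = 𝟘

data _⟶R₂ACh_ (t t' : Term) : Set where
  step : (p : Pos) (ρ : RuleR₂) (σ : Subst) (u : Term)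
       → t ∣ p ≡ just u
       → ¬ IsVar u
       → u ≈ACh (lhs ρ ⟨ σ ⟩)
       → t [ rhs ρ ⟨ σ ⟩ ]at p ≡ just t'
       → t ⟶R₂ACh t'

Reducible : Term → Set
Reducible t = ∃ λ t' → t ⟶R₂ACh t'

-- A term is reducible iff it has a non-variable subterm that is ACh-equal to an
-- instance of a left-hand side. This property is preserved by the congruence
-- cases of AC trivially and by commutativity since matching is modulo ACh.
-- Associativity is the only AC axiom that changes the set of subterms: it
-- destroys the subterm x + y of (x + y) + z. But that subterm can only be a
-- redex for one of the three rules whose left-hand side is a sum, and each of
-- them still applies after adding a summand: x + x + z matches x + (z + x),
-- s + 0 + z matches (s + z) + 0, and x + (y + x) + z matches x + ((y + z) + x).
module Submission where

open import Defs
open import Data.Nat using (zero; suc)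
open import Data.Bool using (Bool; true; false)
open import Data.List using ([]; _∷_)
open import Data.Maybe using (just; map)
open import Data.Product using (Σ; _,_)
open import Function.Bundles using (_⇔_; mk⇔; module Equivalence)
open import Function.Construct.Identity using (⇔-id)
open import Function.Construct.Symmetry using (⇔-sym)
open import Function.Construct.Composition using (_⇔-∘_)
open import Relation.Binary.PropositionalEquality as ≡ using (_≡_)
open import Relation.Nullary using (¬_)

infixr 2 _⟨≈⟩_
_⟨≈⟩_ : ∀ {s t u} → s ≈ACh t → t ≈ACh u → s ≈ACh u
_⟨≈⟩_ = trans

≈AC⇒≈ACh : ∀ {s t} → s ≈AC t → s ≈ACh t
≈AC⇒≈ACh refl          = refl
≈AC⇒≈ACh (sym e)       = sym (≈AC⇒≈ACh e)
≈AC⇒≈ACh (trans e f)   = trans (≈AC⇒≈ACh e) (≈AC⇒≈ACh f)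
≈AC⇒≈ACh (cong⊕ e f)   = cong⊕ (≈AC⇒≈ACh e) (≈AC⇒≈ACh f)
≈AC⇒≈ACh (congh e)     = congh (≈AC⇒≈ACh e)
≈AC⇒≈ACh (assoc x y z) = assoc x y z
≈AC⇒≈ACh (comm x y)    = comm x y

¬IsVar-⊕ : ∀ {s t} → ¬ IsVar (s ⊕ t)
¬IsVar-⊕ (_ , ())

¬IsVar-h : ∀ {t} → ¬ IsVar (h t)
¬IsVar-h (_ , ())

Redex : Term → Set
Redex u = Σ RuleR₂ λ ρ → Σ Subst λ σ → u ≈ACh (lhs ρ ⟨ σ ⟩)

Redex-resp-≈ACh : ∀ {s t} → s ≈ACh t → Redex s → Redex t
Redex-resp-≈ACh e (ρ , σ , q) = ρ , σ , (sym e ⟨≈⟩ q)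

data HasRedex : Term → Set where
  here : ∀ {t}   → ¬ IsVar t → Redex t → HasRedex t
  inˡ  : ∀ {s t} → HasRedex s → HasRedex (s ⊕ t)
  inʳ  : ∀ {s t} → HasRedex t → HasRedex (s ⊕ t)
  inh  : ∀ {t}   → HasRedex t → HasRedex (h t)

⟶-⊕ˡ : ∀ {s s'} t → s ⟶R₂ACh s' → (s ⊕ t) ⟶R₂ACh (s' ⊕ t)
⟶-⊕ˡ t (step p ρ σ u at nv e r) = step (left ∷ p) ρ σ u at nv e (≡.cong (map (_⊕ t)) r)

⟶-⊕ʳ : ∀ s {t t'} → t ⟶R₂ACh t' → (s ⊕ t) ⟶R₂ACh (s ⊕ t')
⟶-⊕ʳ s (step p ρ σ u at nv e r) = step (right ∷ p) ρ σ u at nv e (≡.cong (map (s ⊕_)) r)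

⟶-h : ∀ {t t'} → t ⟶R₂ACh t' → h t ⟶R₂ACh h t'
⟶-h (step p ρ σ u at nv e r) = step (arg ∷ p) ρ σ u at nv e (≡.cong (map h) r)

HasRedex⇒Reducible : ∀ {t} → HasRedex t → Reducible t
HasRedex⇒Reducible (here nv (ρ , σ , e)) = _ , step [] ρ σ _ ≡.refl nv e ≡.refl
HasRedex⇒Reducible {s ⊕ t} (inˡ r) with HasRedex⇒Reducible r
... | s' , s⟶s' = s' ⊕ t , ⟶-⊕ˡ t s⟶s'
HasRedex⇒Reducible {s ⊕ t} (inʳ r) with HasRedex⇒Reducible r
... | t' , t⟶t' = s ⊕ t' , ⟶-⊕ʳ s t⟶t'
HasRedex⇒Reducible (inh r) with HasRedex⇒Reducible r
... | t' , t⟶t' = h t' , ⟶-h t⟶t'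

HasRedex-subterm : ∀ t p {u} → t ∣ p ≡ just u → ¬ IsVar u → Redex u → HasRedex t
HasRedex-subterm t       []          ≡.refl nv r = here nv r
HasRedex-subterm (s ⊕ t) (left ∷ p)  at     nv r = inˡ (HasRedex-subterm s p at nv r)
HasRedex-subterm (s ⊕ t) (right ∷ p) at     nv r = inʳ (HasRedex-subterm t p at nv r)
HasRedex-subterm (h t)   (arg ∷ p)   at     nv r = inh (HasRedex-subterm t p at nv r)
HasRedex-subterm (var _) (_ ∷ _)     ()
HasRedex-subterm (cst _) (_ ∷ _)     ()
HasRedex-subterm 𝟘       (_ ∷ _)     ()
HasRedex-subterm (_ ⊕ _) (arg ∷ _)   ()
HasRedex-subterm (h _)   (left ∷ _)  ()
HasRedex-subterm (h _)   (right ∷ _) ()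

Reducible⇒HasRedex : ∀ {t} → Reducible t → HasRedex t
Reducible⇒HasRedex {t} (_ , step p ρ σ u at nv e _) = HasRedex-subterm t p at nv (ρ , σ , e)

-- Since h distributes over +, being a sum below a tower of h's is ACh-invariant.
isSumUnderH : Term → Bool
isSumUnderH (_ ⊕ _) = true
isSumUnderH (h t)   = isSumUnderH t
isSumUnderH _       = false

isSumUnderH-resp-≈ACh : ∀ {s t} → s ≈ACh t → isSumUnderH s ≡ isSumUnderH t
isSumUnderH-resp-≈ACh refl          = ≡.refl
isSumUnderH-resp-≈ACh (sym e)       = ≡.sym (isSumUnderH-resp-≈ACh e)
isSumUnderH-resp-≈ACh (trans e f)   = ≡.trans (isSumUnderH-resp-≈ACh e) (isSumUnderH-resp-≈ACh f)
isSumUnderH-resp-≈ACh (cong⊕ _ _)   = ≡.refl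
isSumUnderH-resp-≈ACh (congh e)     = isSumUnderH-resp-≈ACh e
isSumUnderH-resp-≈ACh (assoc _ _ _) = ≡.refl
isSumUnderH-resp-≈ACh (comm _ _)    = ≡.refl
isSumUnderH-resp-≈ACh (hom _ _)     = ≡.refl

sum≉h𝟘 : ∀ {s t} → ¬ (s ⊕ t) ≈ACh h 𝟘
sum≉h𝟘 e with isSumUnderH-resp-≈ACh e
... | ()

⟪_,_⟫ : Term → Term → Subst
⟪ a , b ⟫ zero          = a
⟪ a , b ⟫ (suc zero)    = b
⟪ a , b ⟫ (suc (suc _)) = 𝟘

Redex-⊕ʳ : ∀ {s t} u → Redex (s ⊕ t) → Redex ((s ⊕ t) ⊕ u)
Redex-⊕ʳ u (ρ₁ , σ , e) = ρ₃ , ⟪ σ 0 , u ⟫ ,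
  (cong⊕ e refl ⟨≈⟩ assoc _ _ _ ⟨≈⟩ cong⊕ refl (comm _ _))
Redex-⊕ʳ u (ρ₂ , σ , e) = ρ₂ , ⟪ σ 0 ⊕ u , 𝟘 ⟫ ,
  (cong⊕ e refl ⟨≈⟩ assoc _ _ _ ⟨≈⟩ cong⊕ refl (comm _ _) ⟨≈⟩ sym (assoc _ _ _))
Redex-⊕ʳ u (ρ₃ , σ , e) = ρ₃ , ⟪ σ 0 , σ 1 ⊕ u ⟫ ,
  (cong⊕ e refl ⟨≈⟩ assoc _ _ _ ⟨≈⟩
   cong⊕ refl (assoc _ _ _ ⟨≈⟩ cong⊕ refl (comm _ _) ⟨≈⟩ sym (assoc _ _ _)))
Redex-⊕ʳ u (ρ₄ , σ , e) with sum≉h𝟘 e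
... | ()

Redex-⊕ˡ : ∀ {s t} u → Redex (s ⊕ t) → Redex (u ⊕ (s ⊕ t))
Redex-⊕ˡ u r = Redex-resp-≈ACh (comm _ _) (Redex-⊕ʳ u r)

HasRedex-cong⊕ : ∀ {s s' t t'} → (s ⊕ t) ≈ACh (s' ⊕ t') →
                 (HasRedex s → HasRedex s') → (HasRedex t → HasRedex t') →
                 HasRedex (s ⊕ t) → HasRedex (s' ⊕ t')
HasRedex-cong⊕ e f g (here _ r) = here ¬IsVar-⊕ (Redex-resp-≈ACh e r)
HasRedex-cong⊕ e f g (inˡ r)    = inˡ (f r)
HasRedex-cong⊕ e f g (inʳ r)    = inʳ (g r)

HasRedex-congh : ∀ {t t'} → h t ≈ACh h t' → (HasRedex t → HasRedex t') →
                 HasRedex (h t) → HasRedex (h t')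
HasRedex-congh e f (here _ r) = here ¬IsVar-h (Redex-resp-≈ACh e r)
HasRedex-congh e f (inh r)    = inh (f r)

HasRedex-assocʳ : ∀ x y z → HasRedex ((x ⊕ y) ⊕ z) → HasRedex (x ⊕ (y ⊕ z))
HasRedex-assocʳ x y z (here _ r)       = here ¬IsVar-⊕ (Redex-resp-≈ACh (assoc x y z) r)
HasRedex-assocʳ x y z (inˡ (here _ r)) = here ¬IsVar-⊕ (Redex-resp-≈ACh (assoc x y z) (Redex-⊕ʳ z r))
HasRedex-assocʳ x y z (inˡ (inˡ r))    = inˡ r
HasRedex-assocʳ x y z (inˡ (inʳ r))    = inʳ (inˡ r)
HasRedex-assocʳ x y z (inʳ r)          = inʳ (inʳ r)

HasRedex-assocˡ : ∀ x y z → HasRedex (x ⊕ (y ⊕ z)) → HasRedex ((x ⊕ y) ⊕ z)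
HasRedex-assocˡ x y z (here _ r)       = here ¬IsVar-⊕ (Redex-resp-≈ACh (sym (assoc x y z)) r)
HasRedex-assocˡ x y z (inʳ (here _ r)) = here ¬IsVar-⊕ (Redex-resp-≈ACh (sym (assoc x y z)) (Redex-⊕ˡ x r))
HasRedex-assocˡ x y z (inˡ r)          = inˡ (inˡ r)
HasRedex-assocˡ x y z (inʳ (inˡ r))    = inˡ (inʳ r)
HasRedex-assocˡ x y z (inʳ (inʳ r))    = inʳ r

HasRedex-comm : ∀ x y → HasRedex (x ⊕ y) → HasRedex (y ⊕ x)
HasRedex-comm x y (here _ r) = here ¬IsVar-⊕ (Redex-resp-≈ACh (comm x y) r)
HasRedex-comm x y (inˡ r)    = inʳ r
HasRedex-comm x y (inʳ r)    = inˡ r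

HasRedex-resp-≈AC : ∀ {s t} → s ≈AC t → HasRedex s ⇔ HasRedex t
HasRedex-resp-≈AC refl          = ⇔-id _
HasRedex-resp-≈AC (sym e)       = ⇔-sym (HasRedex-resp-≈AC e)
HasRedex-resp-≈AC (trans e f)   = HasRedex-resp-≈AC f ⇔-∘ HasRedex-resp-≈AC e
HasRedex-resp-≈AC (cong⊕ e f)   =
  mk⇔ (HasRedex-cong⊕ E (to e⇔) (to f⇔)) (HasRedex-cong⊕ (sym E) (from e⇔) (from f⇔))
  where
  open Equivalence
  E = ≈AC⇒≈ACh (cong⊕ e f)
  e⇔ = HasRedex-resp-≈AC e
  f⇔ = HasRedex-resp-≈AC f
HasRedex-resp-≈AC (congh e)     =
  mk⇔ (HasRedex-congh E (to e⇔)) (HasRedex-congh (sym E) (from e⇔))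
  where
  open Equivalence
  E = ≈AC⇒≈ACh (congh e)
  e⇔ = HasRedex-resp-≈AC e
HasRedex-resp-≈AC (assoc x y z) = mk⇔ (HasRedex-assocʳ x y z) (HasRedex-assocˡ x y z)
HasRedex-resp-≈AC (comm x y)    = mk⇔ (HasRedex-comm x y) (HasRedex-comm y x)

mainTheorem16 : ∀ (s s' : Term) → Reducible s → s ≈AC s' → Reducible s'
mainTheorem16 s s' r e =
  HasRedex⇒Reducible (Equivalence.to (HasRedex-resp-≈AC e) (Reducible⇒HasRedex r))
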